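{- Let $A$ be an $n\times n$ alternating sign matrix and $P$ an $n\times n$ permutation matrix, and let $z_n=(n,n-1,\dots,2,1)^T$. If $z_n^TA=z_n^TP$, then $A=P$.
   Context: An $n\times n$ alternating sign matrix (ASM) is a $(0,\pm1)$-matrix whose rows and columns each have nonzeros alternating in sign beginning and ending with $+1$. -}

module Defs where

open import Data.Nat using (ℕ; zero; suc)
open import Data.Integer using (ℤ; +_; -[1+_]; _+_; _*_; 0ℤ; 1ℤ; -1ℤ)
open import Data.Fin using (Fin; toℕ)
open import Data.Fin.Permutation using (Permutation′; _⟨$⟩ʳ_)
open import Data.List using (List; []; _∷_; filter)
open import Data.Vec.Functional using (Vector; toList)
open import Data.Integer.Properties using (_≟_)
open import Relation.Nullary using (¬_; Dec; yes; no)
open import Relation.Binary.PropositionalEquality using (_≡_)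
open import Data.Sum using (_⊎_)
open import Data.Fin.Properties using () renaming (_≟_ to _≟ᶠ_)

-- n × n integer matrices, indexed (row, column), 0-based
Matrix : ℕ → Set
Matrix n = Fin n → Fin n → ℤ

ZeroPM1 : ℤ → Set
ZeroPM1 x = (x ≡ 0ℤ) ⊎ (x ≡ 1ℤ) ⊎ (x ≡ -1ℤ)

data AltPlus : List ℤ → Set where
  single : AltPlus (1ℤ ∷ [])
  step   : ∀ {xs} → AltPlus xs → AltPlus (1ℤ ∷ -1ℤ ∷ xs)

nonzeros : List ℤ → List ℤ
nonzeros = filter (λ x → Relation.Nullary.¬? (x ≟ 0ℤ))
  where import Relation.Nullary

row : ∀ {n} → Matrix n → Fin n → List ℤ
row A i = toList (λ j → A i j)

col : ∀ {n} → Matrix n → Fin n → List ℤ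
col A j = toList (λ i → A i j)

record IsASM {n : ℕ} (A : Matrix n) : Set where
  field
    entries : ∀ i j → ZeroPM1 (A i j)
    rows    : ∀ i → AltPlus (nonzeros (row A i))
    cols    : ∀ j → AltPlus (nonzeros (col A j))

permMatrix : ∀ {n} → Permutation′ n → Matrix n
permMatrix σ i j with (σ ⟨$⟩ʳ i) ≟ᶠ j
... | yes _ = 1ℤ
... | no  _ = 0ℤ

IsPermutationMatrix : ∀ {n} → Matrix n → Set
IsPermutationMatrix {n} P = Data.Product.Σ (Permutation′ n) (λ σ → ∀ i j → P i j ≡ permMatrix σ i j)
  where import Data.Product

∑ : ∀ {n} → (Fin n → ℤ) → ℤ
∑ {zero}  f = 0ℤ
∑ {suc n} f = f Fin.zero + ∑ (λ i → f (Fin.suc i))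
  where import Data.Fin as Fin

z : (n : ℕ) → Fin n → ℤ
z n i = + (n Data.Nat.∸ toℕ i)
  where import Data.Nat

zT* : ∀ {n} → Matrix n → Fin n → ℤ
zT* {n} A j = ∑ (λ i → z n i * A i j)

module Submission where

-- Let σ be the permutation of P, let t j = σ⁻¹(j) be the
-- row holding the 1 of column j, and write C k j and S k j for the sums of
-- the first k entries of column j of A and of P respectively.
--  (1) Along a column of an ASM the nonzeros alternate +1, -1, ..., +1, so
--      every C k j is 0 or 1, and every row of A sums to 1.  Rows of P also
--      sum to 1, hence Σ_j C k j = Σ_j S k j for every k.
--  (2) Summation by parts writes (z_n^T A)_j as Σ_{k=1..n} C k j, so the
--      hypothesis z_n^T A = z_n^T P says every column of C has the same sum
--      as the corresponding column of S.
--  (3) S is a staircase: S k j = 1 if t j < k and 0 otherwise.  A 0/1 table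
--      with the same row and column sums as a staircase is that staircase
--      (module StaircaseRigidity), by strong induction on t j.
--  (4) Entries are differences of consecutive prefix sums, so A = P.
-- The file develops finite sums, prefix sums, the alternating-sequence
-- lemma behind (1), unit vectors (rows and columns of P), staircase
-- rigidity, and finally the theorem.

open import Defs
open import Data.Nat using (ℕ; zero; suc; _≤_; _<_; z≤n; s≤s; _≤?_; _<?_)
open import Data.Nat.Properties using (≤-<-trans; <-≤-trans; ≰⇒>; ≮⇒≥; <⇒≤)
open import Data.Nat.Induction using (<-rec)
open import Data.Integer as ℤ using (ℤ; +_; _+_; _*_; 0ℤ; 1ℤ; -1ℤ; +≤+)
open import Data.Integer.Properties
  using (≤-refl; ≤-reflexive; ≤∧≮⇒≡; <-irrefl; +-mono-<-≤; +-mono-≤;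
         +-identityˡ; +-identityʳ; +-assoc; *-zeroʳ; suc-*;
         +-commutativeSemigroup; +-0-abelianGroup)
  renaming (_≟_ to _≟ℤ_)
open import Algebra.Properties.CommutativeSemigroup +-commutativeSemigroup using (interchange)
open import Algebra.Properties.AbelianGroup +-0-abelianGroup using (∙-cancelˡ)
open import Data.Fin using (Fin; toℕ; fromℕ<) renaming (zero to fzero; suc to fsuc)
open import Data.Fin.Properties using (toℕ<n; toℕ-fromℕ<; suc-injective) renaming (_≟_ to _≟ᶠ_)
open import Data.Fin.Permutation using (Permutation′; _⟨$⟩ʳ_; _⟨$⟩ˡ_; inverseˡ; inverseʳ)
open import Data.List using (List; []; _∷_; take; foldr)
open import Data.Vec.Functional using (toList)
open import Data.Product using (_,_)
open import Data.Sum using (_⊎_; inj₁; inj₂)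
open import Data.Empty using (⊥-elim)
open import Relation.Nullary using (yes; no)
open import Relation.Binary.PropositionalEquality
  using (_≡_; _≢_; refl; sym; trans; cong; cong₂; subst; module ≡-Reasoning)
open ≡-Reasoning

Bit : ℤ → Set
Bit x = (x ≡ 0ℤ) ⊎ (x ≡ 1ℤ)

bit≥0 : ∀ {x} → Bit x → 0ℤ ℤ.≤ x
bit≥0 (inj₁ refl) = ≤-refl
bit≥0 (inj₂ refl) = +≤+ z≤n

bit≤1 : ∀ {x} → Bit x → x ℤ.≤ 1ℤ
bit≤1 (inj₁ refl) = +≤+ z≤n
bit≤1 (inj₂ refl) = ≤-refl

∑-+ : ∀ {n} (f g : Fin n → ℤ) → ∑ (λ i → f i + g i) ≡ ∑ f + ∑ g
∑-+ {zero}  f g = refl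
∑-+ {suc n} f g =
  trans (cong (_+_ (f fzero + g fzero)) (∑-+ (λ i → f (fsuc i)) (λ i → g (fsuc i))))
        (interchange (f fzero) (g fzero) _ _)

∑-const : ∀ {n} c → ∑ {n} (λ _ → c) ≡ + n * c
∑-const {zero}  c = refl
∑-const {suc n} c = trans (cong (_+_ c) (∑-const {n} c)) (sym (suc-* (+ n) c))

∑-zero : ∀ {n} → ∑ {n} (λ _ → 0ℤ) ≡ 0ℤ
∑-zero {n} = trans (∑-const {n} 0ℤ) (*-zeroʳ (+ n))

∑-mono : ∀ {n} {f g : Fin n → ℤ} → (∀ i → f i ℤ.≤ g i) → ∑ f ℤ.≤ ∑ g
∑-mono {zero}  f≤g = ≤-refl
∑-mono {suc n} f≤g = +-mono-≤ (f≤g fzero) (∑-mono (λ i → f≤g (fsuc i)))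

-- If f ≤ g pointwise and the sums agree, then f = g: a strict inequality
-- at any index would make the sum of f strictly smaller.
∑-squeeze : ∀ {n} (f g : Fin n → ℤ) → (∀ i → f i ℤ.≤ g i) → ∑ f ≡ ∑ g → ∀ i → f i ≡ g i
∑-squeeze {suc n} f g f≤g ∑f≡∑g fzero = ≤∧≮⇒≡ (f≤g fzero)
  (λ f0<g0 → <-irrefl ∑f≡∑g (+-mono-<-≤ f0<g0 (∑-mono (λ i → f≤g (fsuc i)))))
∑-squeeze {suc n} f g f≤g ∑f≡∑g (fsuc i) =
  ∑-squeeze (λ i → f (fsuc i)) (λ i → g (fsuc i)) (λ i → f≤g (fsuc i)) tails-equal i
  where
  tails-equal : ∑ (λ i → f (fsuc i)) ≡ ∑ (λ i → g (fsuc i))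
  tails-equal = ∙-cancelˡ (g fzero) _ _
    (trans (cong (_+ _) (sym (∑-squeeze f g f≤g ∑f≡∑g fzero))) ∑f≡∑g)

listSum : List ℤ → ℤ
listSum = foldr _+_ 0ℤ

-- prefix k f = f 0 + ... + f (k-1)  (all of f when k ≥ n).  On a successor
-- it unfolds definitionally: prefix (1+k) f = f 0 + prefix k (f ∘ suc).
prefix : ∀ {n} → ℕ → (Fin n → ℤ) → ℤ
prefix k f = listSum (take k (toList f))

prefix-cong : ∀ {n} k {f g : Fin n → ℤ} → (∀ i → f i ≡ g i) → prefix k f ≡ prefix k g
prefix-cong zero    f≡g = refl
prefix-cong {zero}  (suc k) f≡g = refl
prefix-cong {suc n} (suc k) f≡g = cong₂ _+_ (f≡g fzero) (prefix-cong k (λ i → f≡g (fsuc i)))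

prefix-vanishing : ∀ {n} k (f : Fin n → ℤ) → (∀ i → f i ≡ 0ℤ) → prefix k f ≡ 0ℤ
prefix-vanishing zero    f f≡0 = refl
prefix-vanishing {zero}  (suc k) f f≡0 = refl
prefix-vanishing {suc n} (suc k) f f≡0 =
  cong₂ _+_ (f≡0 fzero) (prefix-vanishing k (λ i → f (fsuc i)) (λ i → f≡0 (fsuc i)))

prefix-total : ∀ {n} (f : Fin n → ℤ) → prefix n f ≡ ∑ f
prefix-total {zero}  f = refl
prefix-total {suc n} f = cong (_+_ (f fzero)) (prefix-total (λ i → f (fsuc i)))

∑-as-listSum : ∀ {n} (f : Fin n → ℤ) → ∑ f ≡ listSum (toList f)
∑-as-listSum {zero}  f = refl
∑-as-listSum {suc n} f = cong (_+_ (f fzero)) (∑-as-listSum (λ i → f (fsuc i)))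

prefix-step : ∀ {n} (i : Fin n) (f : Fin n → ℤ) → prefix (suc (toℕ i)) f ≡ prefix (toℕ i) f + f i
prefix-step fzero    f = trans (+-identityʳ (f fzero)) (sym (+-identityˡ (f fzero)))
prefix-step (fsuc i) f =
  trans (cong (_+_ (f fzero)) (prefix-step i (λ j → f (fsuc j)))) (sym (+-assoc (f fzero) _ _))

prefixes-determine-entries : ∀ {n} (f g : Fin n → ℤ) →
  (∀ k → k ≤ n → prefix k f ≡ prefix k g) → ∀ i → f i ≡ g i
prefixes-determine-entries f g same i = ∙-cancelˡ (prefix (toℕ i) g) (f i) (g i) (begin
  prefix (toℕ i) g + f i        ≡⟨ cong (_+ f i) (sym (same (toℕ i) (<⇒≤ (toℕ<n i)))) ⟩
  prefix (toℕ i) f + f i        ≡⟨ sym (prefix-step i f) ⟩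
  prefix (suc (toℕ i)) f        ≡⟨ same (suc (toℕ i)) (toℕ<n i) ⟩
  prefix (suc (toℕ i)) g        ≡⟨ prefix-step i g ⟩
  prefix (toℕ i) g + g i        ∎)

∑-prefix-swap : ∀ {m n} k (M : Fin m → Fin n → ℤ) →
  ∑ (λ j → prefix k (λ i → M i j)) ≡ prefix k (λ i → ∑ (M i))
∑-prefix-swap {n = n} zero M = ∑-zero {n}
∑-prefix-swap {zero} {n} (suc k) M = ∑-zero {n}
∑-prefix-swap {suc m} (suc k) M =
  trans (∑-+ (M fzero) (λ j → prefix k (λ i → M (fsuc i) j)))
        (cong (_+_ (∑ (M fzero))) (∑-prefix-swap k (λ i → M (fsuc i))))

prefix-row-counts : ∀ {n} (A B : Matrix n) → (∀ i → ∑ (A i) ≡ ∑ (B i)) →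
  ∀ k → ∑ (λ j → prefix k (λ i → A i j)) ≡ ∑ (λ j → prefix k (λ i → B i j))
prefix-row-counts A B rows k = begin
  ∑ (λ j → prefix k (λ i → A i j)) ≡⟨ ∑-prefix-swap k A ⟩
  prefix k (λ i → ∑ (A i))         ≡⟨ prefix-cong k rows ⟩
  prefix k (λ i → ∑ (B i))         ≡⟨ sym (∑-prefix-swap k B) ⟩
  ∑ (λ j → prefix k (λ i → B i j)) ∎

-- Summation by parts: Σ_i (n - i) f i = Σ_{k=1..n} (f 0 + ... + f (k-1)),
-- since f i occurs in exactly the n - i prefixes of length > i.
weighted-sum-by-parts : ∀ n (f : Fin n → ℤ) →
  ∑ (λ i → z n i * f i) ≡ ∑ {n} (λ k → prefix (suc (toℕ k)) f)
weighted-sum-by-parts zero    f = refl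
weighted-sum-by-parts (suc m) f = begin
  + suc m * f fzero + ∑ (λ i → z m i * f (fsuc i))
    ≡⟨ cong₂ _+_ (suc-* (+ m) (f fzero)) (weighted-sum-by-parts m (λ i → f (fsuc i))) ⟩
  (f fzero + + m * f fzero) + rest
    ≡⟨ +-assoc (f fzero) _ _ ⟩
  f fzero + (+ m * f fzero + rest)
    ≡⟨ cong₂ _+_ (sym (+-identityʳ (f fzero))) (cong (_+ rest) (sym (∑-const {m} (f fzero)))) ⟩
  (f fzero + 0ℤ) + (∑ {m} (λ _ → f fzero) + rest)
    ≡⟨ cong (_+_ (f fzero + 0ℤ)) (sym (∑-+ {m} (λ _ → f fzero) (λ k → prefix (suc (toℕ k)) (λ i → f (fsuc i))))) ⟩
  (f fzero + 0ℤ) + ∑ {m} (λ k → f fzero + prefix (suc (toℕ k)) (λ i → f (fsuc i))) ∎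
  where
  rest : ℤ
  rest = ∑ {m} (λ k → prefix (suc (toℕ k)) (λ i → f (fsuc i)))

-- AltFrom s ys: ys continues a sequence +1, -1, ..., +1 after an initial
-- part with sum s.
data AltFrom : ℤ → List ℤ → Set where
  done  : AltFrom 1ℤ []
  plus  : ∀ {ys} → AltFrom 1ℤ ys → AltFrom 0ℤ (1ℤ ∷ ys)
  minus : ∀ {ys} → AltFrom 0ℤ ys → AltFrom 1ℤ (-1ℤ ∷ ys)

altPlus⇒altFrom : ∀ {ys} → AltPlus ys → AltFrom 0ℤ ys
altPlus⇒altFrom single    = plus done
altPlus⇒altFrom (step ys) = plus (minus (altPlus⇒altFrom ys))

altFrom-bit : ∀ {s ys} → AltFrom s ys → Bit s
altFrom-bit done      = inj₂ refl
altFrom-bit (plus _)  = inj₁ refl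
altFrom-bit (minus _) = inj₂ refl

one-minus-one : ∀ y → 1ℤ + (-1ℤ + y) ≡ y
one-minus-one y = trans (sym (+-assoc 1ℤ -1ℤ y)) (+-identityˡ y)

running-sum-bits : ∀ s xs → AltFrom s (nonzeros xs) → ∀ k → Bit (s + listSum (take k xs))
running-sum-bits .1ℤ [] done zero    = inj₂ refl
running-sum-bits .1ℤ [] done (suc k) = inj₂ refl
running-sum-bits s (x ∷ xs) alt k with x ≟ℤ 0ℤ
running-sum-bits s (x ∷ xs) alt zero    | yes refl =
  subst Bit (sym (+-identityʳ s)) (altFrom-bit alt)
running-sum-bits s (x ∷ xs) alt (suc k) | yes refl =
  subst Bit (cong (_+_ s) (sym (+-identityˡ _))) (running-sum-bits s xs alt k)
running-sum-bits .0ℤ (x ∷ xs) (plus alt)  zero    | no _ = inj₁ refl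
running-sum-bits .0ℤ (x ∷ xs) (plus alt)  (suc k) | no _ =
  subst Bit (sym (+-identityˡ _)) (running-sum-bits 1ℤ xs alt k)
running-sum-bits .1ℤ (x ∷ xs) (minus alt) zero    | no _ = inj₂ refl
running-sum-bits .1ℤ (x ∷ xs) (minus alt) (suc k) | no _ =
  subst Bit (trans (+-identityˡ L) (sym (one-minus-one L))) (running-sum-bits 0ℤ xs alt k)
  where L = listSum (take k xs)

running-sum-total : ∀ s xs → AltFrom s (nonzeros xs) → s + listSum xs ≡ 1ℤ
running-sum-total .1ℤ [] done = refl
running-sum-total s (x ∷ xs) alt with x ≟ℤ 0ℤ
... | yes refl = trans (cong (_+_ s) (+-identityˡ _)) (running-sum-total s xs alt)
running-sum-total .0ℤ (x ∷ xs) (plus alt)  | no _ =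
  trans (+-identityˡ _) (running-sum-total 1ℤ xs alt)
running-sum-total .1ℤ (x ∷ xs) (minus alt) | no _ =
  trans (trans (one-minus-one (listSum xs)) (sym (+-identityˡ (listSum xs)))) (running-sum-total 0ℤ xs alt)

alternating-prefix-bits : ∀ {xs} → AltPlus (nonzeros xs) → ∀ k → Bit (listSum (take k xs))
alternating-prefix-bits {xs} alt k =
  subst Bit (+-identityˡ _) (running-sum-bits 0ℤ xs (altPlus⇒altFrom alt) k)

alternating-total : ∀ {xs} → AltPlus (nonzeros xs) → listSum xs ≡ 1ℤ
alternating-total {xs} alt =
  trans (sym (+-identityˡ _)) (running-sum-total 0ℤ xs (altPlus⇒altFrom alt))

asm-column-prefix-bit : ∀ {n} {A : Matrix n} → IsASM A → ∀ k j → Bit (prefix k (λ i → A i j))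
asm-column-prefix-bit asm k j = alternating-prefix-bits (IsASM.cols asm j) k

asm-row-sum : ∀ {n} {A : Matrix n} → IsASM A → ∀ i → ∑ (A i) ≡ 1ℤ
asm-row-sum {A = A} asm i = trans (∑-as-listSum (A i)) (alternating-total {row A i} (IsASM.rows asm i))

record UnitVector {n} (r : Fin n) (f : Fin n → ℤ) : Set where
  field
    at  : f r ≡ 1ℤ
    off : ∀ i → i ≢ r → f i ≡ 0ℤ
open UnitVector

unit-tail : ∀ {n} {r : Fin n} {f} → UnitVector (fsuc r) f → UnitVector r (λ i → f (fsuc i))
unit-tail u = record { at = at u ; off = λ i i≢r → off u (fsuc i) (λ eq → i≢r (suc-injective eq)) }

unit-prefix-before : ∀ {n} {r : Fin n} {f} → UnitVector r f → ∀ k → k ≤ toℕ r → prefix k f ≡ 0ℤ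
unit-prefix-before u zero _ = refl
unit-prefix-before {r = fsuc r} u (suc k) (s≤s k≤r) =
  cong₂ _+_ (off u fzero (λ ())) (unit-prefix-before (unit-tail u) k k≤r)

unit-prefix-after : ∀ {n} {r : Fin n} {f} → UnitVector r f → ∀ k → toℕ r < k → prefix k f ≡ 1ℤ
unit-prefix-after {r = fzero} {f} u (suc k) _ =
  cong₂ _+_ (at u) (prefix-vanishing k (λ i → f (fsuc i)) (λ i → off u (fsuc i) (λ ())))
unit-prefix-after {r = fsuc r} u (suc k) (s≤s r<k) =
  cong₂ _+_ (off u fzero (λ ())) (unit-prefix-after (unit-tail u) k r<k)

unit-sum : ∀ {n} {r : Fin n} {f} → UnitVector r f → ∑ f ≡ 1ℤ
unit-sum {n} {r} {f} u = trans (sym (prefix-total f)) (unit-prefix-after u n (toℕ<n r))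

permMatrix-hit : ∀ {n} (σ : Permutation′ n) i j → σ ⟨$⟩ʳ i ≡ j → permMatrix σ i j ≡ 1ℤ
permMatrix-hit σ i j σi≡j with (σ ⟨$⟩ʳ i) ≟ᶠ j
... | yes _    = refl
... | no σi≢j = ⊥-elim (σi≢j σi≡j)

permMatrix-miss : ∀ {n} (σ : Permutation′ n) i j → σ ⟨$⟩ʳ i ≢ j → permMatrix σ i j ≡ 0ℤ
permMatrix-miss σ i j σi≢j with (σ ⟨$⟩ʳ i) ≟ᶠ j
... | yes σi≡j = ⊥-elim (σi≢j σi≡j)
... | no _     = refl

row-unit : ∀ {n} {P : Matrix n} (σ : Permutation′ n) → (∀ i j → P i j ≡ permMatrix σ i j) →
  ∀ i → UnitVector (σ ⟨$⟩ʳ i) (P i)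
row-unit σ P≡σ i = record
  { at  = trans (P≡σ i _) (permMatrix-hit σ i _ refl)
  ; off = λ j j≢σi → trans (P≡σ i j) (permMatrix-miss σ i j (λ σi≡j → j≢σi (sym σi≡j)))
  }

column-unit : ∀ {n} {P : Matrix n} (σ : Permutation′ n) → (∀ i j → P i j ≡ permMatrix σ i j) →
  ∀ j → UnitVector (σ ⟨$⟩ˡ j) (λ i → P i j)
column-unit σ P≡σ j = record
  { at  = trans (P≡σ _ j) (permMatrix-hit σ _ j (inverseʳ σ))
  ; off = λ i i≢σ⁻¹j → trans (P≡σ i j)
      (permMatrix-miss σ i j (λ σi≡j → i≢σ⁻¹j (trans (sym (inverseˡ σ)) (cong (σ ⟨$⟩ˡ_) σi≡j))))
  }

module StaircaseRigidity
  {n : ℕ} (t : Fin n → ℕ) (t<n : ∀ j → t j < n)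
  (C S : ℕ → Fin n → ℤ)
  (C-bit : ∀ k j → Bit (C k j))
  (S-above : ∀ k j → k ≤ t j → S k j ≡ 0ℤ)
  (S-below : ∀ k j → t j < k → S k j ≡ 1ℤ)
  (row-sums : ∀ k → ∑ (λ j → C k j) ≡ ∑ (λ j → S k j))
  (column-sums : ∀ j → ∑ {n} (λ k → C (suc (toℕ k)) j) ≡ ∑ {n} (λ k → S (suc (toℕ k)) j))
  where

  Agrees : Fin n → Set
  Agrees j = ∀ k → k ≤ n → C k j ≡ S k j

  -- induction hypothesis for column j: all columns with an earlier step agree
  EarlierAgree : Fin n → Set
  EarlierAgree j = ∀ j′ → t j′ < t j → Agrees j′

  -- In a row k ≤ t j, columns with an earlier step agree with S and the
  -- others satisfy S = 0 ≤ C; equal row sums force C k j = S k j = 0.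
  above-step : ∀ j → EarlierAgree j → ∀ k → k ≤ t j → C k j ≡ 0ℤ
  above-step j earlier k k≤tj =
    trans (sym (∑-squeeze (λ j′ → S k j′) (λ j′ → C k j′) S≤C (sym (row-sums k)) j))
          (S-above k j k≤tj)
    where
    S≤C : ∀ j′ → S k j′ ℤ.≤ C k j′
    S≤C j′ with t j′ <? k
    ... | yes tj′<k = ≤-reflexive (sym (earlier j′ (<-≤-trans tj′<k k≤tj) k
                        (<⇒≤ (≤-<-trans k≤tj (t<n j)))))
    ... | no  tj′≮k = subst (ℤ._≤ C k j′) (sym (S-above k j′ (≮⇒≥ tj′≮k))) (bit≥0 (C-bit k j′))

  -- Given that, C ≤ S on column j in rows 1..n (both 0 above the step,
  -- S = 1 below it), and equal column sums force equality.
  below-step : ∀ j → EarlierAgree j → ∀ (k : Fin n) → C (suc (toℕ k)) j ≡ S (suc (toℕ k)) j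
  below-step j earlier = ∑-squeeze (λ k → C (suc (toℕ k)) j) (λ k → S (suc (toℕ k)) j)
                                   C≤S (column-sums j)
    where
    C≤S : ∀ k → C (suc (toℕ k)) j ℤ.≤ S (suc (toℕ k)) j
    C≤S k with suc (toℕ k) ≤? t j
    ... | yes k<tj = ≤-reflexive (trans (above-step j earlier _ k<tj) (sym (S-above _ j k<tj)))
    ... | no  k≮tj = subst (C (suc (toℕ k)) j ℤ.≤_) (sym (S-below _ j (≰⇒> k≮tj)))
                           (bit≤1 (C-bit (suc (toℕ k)) j))

  column-agrees : ∀ j → EarlierAgree j → Agrees j
  column-agrees j earlier zero _ = trans (above-step j earlier 0 z≤n) (sym (S-above 0 j z≤n))
  column-agrees j earlier (suc k) k<n =
    subst (λ m → C (suc m) j ≡ S (suc m) j) (toℕ-fromℕ< k<n) (below-step j earlier (fromℕ< k<n))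

  staircase-rigid : ∀ j → Agrees j
  staircase-rigid j = <-rec (λ T → ∀ j → t j ≡ T → Agrees j) induction-step (t j) j refl
    where
    induction-step : ∀ T → (∀ {T′} → T′ < T → ∀ j → t j ≡ T′ → Agrees j) → ∀ j → t j ≡ T → Agrees j
    induction-step T ih j refl = column-agrees j (λ j′ tj′<tj → ih tj′<tj j′ refl)

lemma3p6 : (n : ℕ) (A P : Matrix n) → IsASM A → IsPermutationMatrix P →
    (∀ j → zT* A j ≡ zT* P j) → ∀ i j → A i j ≡ P i j
lemma3p6 n A P asm (σ , P≡σ) zA≡zP i j =
  prefixes-determine-entries (λ i → A i j) (λ i → P i j) (staircase-rigid j) i
  where
  same-row-sums : ∀ i → ∑ (A i) ≡ ∑ (P i)
  same-row-sums i = trans (asm-row-sum asm i) (sym (unit-sum (row-unit σ P≡σ i)))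

  same-column-sums : ∀ j → ∑ {n} (λ k → prefix (suc (toℕ k)) (λ i → A i j))
                         ≡ ∑ {n} (λ k → prefix (suc (toℕ k)) (λ i → P i j))
  same-column-sums j = trans (sym (weighted-sum-by-parts n (λ i → A i j)))
                             (trans (zA≡zP j) (weighted-sum-by-parts n (λ i → P i j)))

  open StaircaseRigidity (λ j → toℕ (σ ⟨$⟩ˡ j)) (λ j → toℕ<n (σ ⟨$⟩ˡ j))
    (λ k j → prefix k (λ i → A i j)) (λ k j → prefix k (λ i → P i j))
    (asm-column-prefix-bit asm)
    (λ k j → unit-prefix-before (column-unit σ P≡σ j) k)
    (λ k j → unit-prefix-after (column-unit σ P≡σ j) k)
    (prefix-row-counts A P same-row-sums)
    same-column-sums
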